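{- Let $T$ and $U$ be normal Aronszajn trees and let $(x,f)$ and $(y,g)$ be conditions in $\mathbb{Q}(T,U)$. Suppose that $\alpha < \beta < \omega_1$ are limit ordinals such that: (1) $\alpha \in x$ and $\beta \in y$; (2) $x \subseteq \beta$ and $x \cap \alpha = y \cap \beta$; (3) $f \upharpoonright (T \upharpoonright \alpha) = g \upharpoonright (T \upharpoonright \beta)$; (4) for all $a,b \in \mathrm{dom}(g) \cap T_\beta$, the ordinals $\Delta_T(a,b)$ and $\Delta_U(g(a),g(b))$ are less than $\alpha$; (5) every member of $\mathrm{dom}(f) \setminus (T \upharpoonright \alpha)$ is incomparable in $T$ with every member of $\mathrm{dom}(g) \setminus (T \upharpoonright \beta)$, and every member of $\mathrm{ran}(f) \setminus (U \upharpoonright \alpha)$ is incomparable in $U$ with every member of $\mathrm{ran}(g) \setminus (U \upharpoonright \beta)$. Then $(x,f)$ and $(y,g)$ are compatible in $\mathbb{Q}(T,U)$.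
   Context: An Aronszajn tree is a tree of height $\omega_1$ with countable levels and no cofinal branch. A tree is normal if it has a root, every element has at least two immediate successors, every element has elements above it at every higher level, and every chain of limit order type has at most one upper bound. $T_\gamma$ is level $\gamma$ of $T$; $T \upharpoonright \gamma$ is the union of the levels below $\gamma$; for a set $x$ of ordinals $T \upharpoonright x$ is the set of elements with height in $x$. For incomparable $a,b$ in $T$, $\Delta_T(a,b)$ is the order type of the set of elements below both $a$ and $b$. For normal Aronszajn trees $T,U$, $\mathbb{Q}(T,U)$ is the forcing poset of all pairs $(x,f)$ where $x$ is a finite set of countable limit ordinals and $f$ is an injective, strictly increasing, height preserving function whose domain is a finite downwards closed subset of $T \upharpoonright x$ and whose values lie in $U$; $(y,g) \le (x,f)$ iff $x \subseteq y$ and $f \subseteq g$. -}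

module Defs where

open import Data.Nat using (ℕ)
open import Data.Product using (Σ; ∃; _×_; _,_)
open import Data.Sum using (_⊎_)
open import Data.List using (List)
open import Data.List.Membership.Propositional using (_∈_)
open import Relation.Nullary using (¬_)
open import Relation.Binary.PropositionalEquality using (_≡_; _≢_)
open import Relation.Binary using (Rel; IsStrictTotalOrder)
open import Induction.WellFounded using (WellFounded)

record OrderIso {X Y : Set} (_<X_ : Rel X _) (_<Y_ : Rel Y _)
                (P : X → Set) (Q : Y → Set) : Set where
  field
    h        : (x : X) → P x → Y
    into     : ∀ x (p : P x) → Q (h x p)
    inj      : ∀ x x' (p : P x) (p' : P x') → h x p ≡ h x' p' → x ≡ x'
    surj     : ∀ y → Q y → Σ X λ x → Σ (P x) λ p → h x p ≡ y
    mono     : ∀ x x' (p : P x) (p' : P x') → x <X x' → h x p <Y h x' p'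
    reflect  : ∀ x x' (p : P x) (p' : P x') → h x p <Y h x' p' → x <X x'

-- A model of ω₁: an uncountable well-order all of whose proper initial
-- segments are countable (classically this determines ω₁ up to iso).

record Omega1 : Set₁ where
  field
    Ω     : Set
    _<_   : Rel Ω _
    isSTO : IsStrictTotalOrder _≡_ _<_
    wf    : WellFounded _<_
    segCountable : ∀ α → Σ ((β : Ω) → β < α → ℕ) λ e →
                     ∀ β β' (p : β < α) (p' : β' < α) → e β p ≡ e β' p' → β ≡ β'
    uncountable  : ¬ (Σ (Ω → ℕ) λ e → ∀ β β' → e β ≡ e β' → β ≡ β')

  IsLimit : Ω → Set
  IsLimit α = (∃ λ β → β < α) × (∀ β → β < α → ∃ λ γ → β < γ × γ < α)

-- Trees of height ω₁: a strict partial order in which the predecessors of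
-- each element are well-ordered, with height = order type of predecessors.

module _ (W : Omega1) where
  open Omega1 W

  record Tree : Set₁ where
    field
      Carrier : Set
      _<ₜ_    : Rel Carrier _
      irrefl  : ∀ t → ¬ (t <ₜ t)
      trans   : ∀ {s t u} → s <ₜ t → t <ₜ u → s <ₜ u
      predLin : ∀ t u v → u <ₜ t → v <ₜ t → (u ≡ v) ⊎ (u <ₜ v) ⊎ (v <ₜ u)
      ht      : Carrier → Ω
      htIso   : ∀ t → OrderIso _<ₜ_ _<_ (λ u → u <ₜ t) (λ β → β < ht t)
      -- height ω₁: every level is nonempty
      levelsNonempty : ∀ α → ∃ λ t → ht t ≡ α

    Incomparable : Carrier → Carrier → Set
    Incomparable a b = a ≢ b × ¬ (a <ₜ b) × ¬ (b <ₜ a)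

    -- Δ(a,b) < α : the order type of {u | u < a and u < b} is below α
    ΔBelow : Carrier → Carrier → Ω → Set
    ΔBelow a b α = Σ Ω λ γ → γ < α ×
                 OrderIso _<ₜ_ _<_ (λ u → u <ₜ a × u <ₜ b) (λ δ → δ < γ)

    IsChain : (Carrier → Set) → Set
    IsChain B = ∀ a b → B a → B b → (a ≡ b) ⊎ (a <ₜ b) ⊎ (b <ₜ a)

    IsImmSucc : Carrier → Carrier → Set
    IsImmSucc t s = t <ₜ s × (∀ u → t <ₜ u → ¬ (u <ₜ s))

  record IsAronszajn (T : Tree) : Set₁ where
    open Tree T
    field
      countableLevels : ∀ α → Σ ((t : Carrier) → ht t ≡ α → ℕ) λ e →
                          ∀ s t (p : ht s ≡ α) (q : ht t ≡ α) → e s p ≡ e t q → s ≡ t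
      noCofinalBranch : ¬ (Σ (Carrier → Set) λ B → IsChain B ×
                                 (∀ α → ∃ λ t → B t × ht t ≡ α))

  record IsNormal (T : Tree) : Set where
    open Tree T
    field
      root        : ∃ λ r → ∀ t → (t ≡ r) ⊎ (r <ₜ t)
      twoSucc     : ∀ t → ∃ λ s₁ → ∃ λ s₂ → s₁ ≢ s₂ × IsImmSucc t s₁ × IsImmSucc t s₂
      extendUp    : ∀ t α → ht t < α → ∃ λ s → t <ₜ s × ht s ≡ α
      limitUnique : ∀ s s' → ht s ≡ ht s' → IsLimit (ht s) →
                      (∀ u → (u <ₜ s → u <ₜ s') × (u <ₜ s' → u <ₜ s)) → s ≡ s'

  module _ (T U : Tree) where
    private
      module T = Tree T
      module U = Tree U

    record Condition : Set where
      field
        x : List Ω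
        f : List (T.Carrier × U.Carrier)
        xLimit     : ∀ ξ → ξ ∈ x → IsLimit ξ
        functional : ∀ a u v → (a , u) ∈ f → (a , v) ∈ f → u ≡ v
        injective  : ∀ a b u → (a , u) ∈ f → (b , u) ∈ f → a ≡ b
        increasing : ∀ a b u v → (a , u) ∈ f → (b , v) ∈ f → a T.<ₜ b → u U.<ₜ v
        htPres     : ∀ a u → (a , u) ∈ f → U.ht u ≡ T.ht a
        domInTx    : ∀ a u → (a , u) ∈ f → T.ht a ∈ x
        domDown    : ∀ a u b → (a , u) ∈ f → b T.<ₜ a → T.ht b ∈ x →
                       ∃ λ v → (b , v) ∈ f

    open Condition public

    _≤Q_ : Condition → Condition → Set
    q ≤Q p = (∀ ξ → ξ ∈ x p → ξ ∈ x q) × (∀ z → z ∈ f p → z ∈ f q)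

    Compatible : Condition → Condition → Set
    Compatible p q = Σ Condition λ r → r ≤Q p × r ≤Q q

-- The amalgam has levels x ∪ y and function f ∪ g ∪ h, where h adds, for every pair (a , u)
-- of g on level β and every level γ ∈ x with γ ≥ α, the predecessors of a and u on level γ;
-- without h the domain would not be downwards closed.  By (4) two distinct pairs of g on
-- level β already split below α, so a pair of h determines the pair of g it comes from.
-- With (5), which keeps the new parts of f and of g apart, this makes f ∪ g ∪ h an
-- injective, strictly increasing function.

module Submission where

open import Defs
open import Data.Product using (Σ; ∃; _×_; _,_)
open import Data.List.Membership.Propositional using (_∈_)
open import Relation.Nullary using (¬_)
open import Relation.Binary.PropositionalEquality using (_≡_; _≢_)

open import Data.Product using (proj₁; proj₂; map₂)
open import Axiom.UniquenessOfIdentityProofs using (module Decidable⇒UIP)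
open import Data.Empty using (⊥-elim)
open import Data.List using (List; []; [_]; _++_; concatMap)
open import Data.List.Membership.Propositional using (find; lose)
open import Data.List.Membership.Propositional.Properties
  using (∈-++⁺ˡ; ∈-++⁺ʳ; ∈-++⁻; ∈-concatMap⁺; ∈-concatMap⁻)
open import Data.List.Relation.Unary.Any using (here; there)
import Data.Nat as ℕ
open import Data.Sum using (inj₁; inj₂; [_,_]′)
open import Function using (id)
open import Induction.WellFounded using (Acc; acc)
open import Relation.Binary using (IsStrictTotalOrder; tri<; tri≈; tri>)
open import Relation.Binary.PropositionalEquality using (refl; sym; trans; cong; subst; subst₂)
open import Relation.Nullary using (Dec; yes; no)

module TreeFacts (W : Omega1) (T : Tree W) where
  open Omega1 W
  open Tree T renaming (trans to <ₜ-trans)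
  open OrderIso
  private module O = IsStrictTotalOrder isSTO

  <-irrefl : ∀ {γ} → ¬ (γ < γ)
  <-irrefl = O.irrefl refl

  OntoSegment : (Carrier → Set) → Ω → Set
  OntoSegment S γ = OrderIso _<ₜ_ _<_ S (λ δ → δ < γ)

  h-irrelevant : ∀ {S γ} (φ : OntoSegment S γ) t (s s′ : S t) → h φ t s ≡ h φ t s′
  h-irrelevant φ t s s′ with O.compare (h φ t s) (h φ t s′)
  ... | tri< l _ _ = ⊥-elim (irrefl t (reflect φ t t s s′ l))
  ... | tri≈ _ e _ = e
  ... | tri> _ _ l = ⊥-elim (irrefl t (reflect φ t t s′ s l))

  module _ {S : Carrier → Set} {γ₁ γ₂ : Ω} (φ₁ : OntoSegment S γ₁) (φ₂ : OntoSegment S γ₂) where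

    private
      agree-at : ∀ δ → Acc _<_ δ → ∀ t (st : S t) → h φ₁ t st ≡ δ → h φ₂ t st ≡ δ
      agree-at δ (acc rs) t st refl with O.compare (h φ₂ t st) δ
      ... | tri≈ _ e _ = e
      ... | tri< φ₂t<δ _ _ with surj φ₁ (h φ₂ t st) (O.trans φ₂t<δ (into φ₁ t st))
      ...   | s , ss , φ₁s≡φ₂t
              with inj φ₂ s t ss st (trans (agree-at _ (rs (subst (_< δ) (sym φ₁s≡φ₂t) φ₂t<δ)) s ss refl) φ₁s≡φ₂t)
      ...     | refl = ⊥-elim (<-irrefl (subst (_< δ) (sym (trans (h-irrelevant φ₁ t st ss) φ₁s≡φ₂t)) φ₂t<δ))
      agree-at δ (acc rs) t st refl | tri> _ _ δ<φ₂t
        with surj φ₂ δ (O.trans δ<φ₂t (into φ₂ t st))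
      ... | s , ss , φ₂s≡δ =
        let φ₁s<δ = mono φ₁ s t ss st (reflect φ₂ s t ss st (subst (_< h φ₂ t st) (sym φ₂s≡δ) δ<φ₂t))
        in ⊥-elim (<-irrefl (subst (_< δ) (trans (sym (agree-at _ (rs φ₁s<δ) s ss refl)) φ₂s≡δ) φ₁s<δ))

    onto-segment-unique : ∀ t (st : S t) → h φ₁ t st ≡ h φ₂ t st
    onto-segment-unique t st = sym (agree-at _ (wf _) t st refl)

    segment-length-unique : γ₁ ≡ γ₂
    segment-length-unique with O.compare γ₁ γ₂
    ... | tri≈ _ e _ = e
    ... | tri< γ₁<γ₂ _ _ with surj φ₂ γ₁ γ₁<γ₂
    ...   | s , ss , e = ⊥-elim (<-irrefl (subst (_< γ₁) (trans (onto-segment-unique s ss) e) (into φ₁ s ss)))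
    segment-length-unique | tri> _ _ γ₂<γ₁ with surj φ₁ γ₂ γ₂<γ₁
    ...   | s , ss , e = ⊥-elim (<-irrefl (subst (_< γ₂) (trans (sym (onto-segment-unique s ss)) e) (into φ₂ s ss)))

  onto-segment-is-ht : ∀ {S γ} → (∀ {s t} → s <ₜ t → S t → S s) →
                       (φ : OntoSegment S γ) → ∀ t (st : S t) → h φ t st ≡ ht t
  onto-segment-is-ht down φ t st = segment-length-unique below-t (htIso t)
    where
    below-t : OntoSegment (λ s → s <ₜ t) (h φ t st)
    below-t = record
      { h       = λ s s<t → h φ s (down s<t st)
      ; into    = λ s s<t → mono φ s t _ st s<t
      ; inj     = λ s s′ _ _ → inj φ s s′ _ _
      ; surj    = λ δ δ<φt → let (s , ss , e) = surj φ δ (O.trans δ<φt (into φ t st))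
                                 s<t = reflect φ s t ss st (subst (_< h φ t st) (sym e) δ<φt)
                             in s , s<t , trans (h-irrelevant φ s _ ss) e
      ; mono    = λ s s′ _ _ → mono φ s s′ _ _
      ; reflect = λ s s′ _ _ → reflect φ s s′ _ _
      }

  htIso-is-ht : ∀ {s t} (s<t : s <ₜ t) → h (htIso t) s s<t ≡ ht s
  htIso-is-ht {s} {t} = onto-segment-is-ht (λ r<s s<t → <ₜ-trans r<s s<t) (htIso t) s

  ht-mono : ∀ {s t} → s <ₜ t → ht s < ht t
  ht-mono {s} {t} s<t = subst (_< ht t) (htIso-is-ht s<t) (into (htIso t) s s<t)

  pred-at : ∀ t {γ} → γ < ht t → Σ Carrier λ s → s <ₜ t × ht s ≡ γ
  pred-at t γ<t with surj (htIso t) _ γ<t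
  ... | s , s<t , e = s , s<t , trans (sym (htIso-is-ht s<t)) e

  preds-≡ : ∀ {s s′ t} → s <ₜ t → s′ <ₜ t → ht s ≡ ht s′ → s ≡ s′
  preds-≡ {s} {s′} {t} s<t s′<t e with predLin t s s′ s<t s′<t
  ... | inj₁ s≡s′        = s≡s′
  ... | inj₂ (inj₁ s<s′) = ⊥-elim (<-irrefl (subst (_< ht s′) e (ht-mono s<s′)))
  ... | inj₂ (inj₂ s′<s) = ⊥-elim (<-irrefl (subst (ht s′ <_) e (ht-mono s′<s)))

  preds-< : ∀ {s s′ t} → s <ₜ t → s′ <ₜ t → ht s < ht s′ → s <ₜ s′
  preds-< {s} {s′} {t} s<t s′<t l with predLin t s s′ s<t s′<t
  ... | inj₁ refl        = ⊥-elim (<-irrefl l)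
  ... | inj₂ (inj₁ s<s′) = s<s′
  ... | inj₂ (inj₂ s′<s) = ⊥-elim (<-irrefl (O.trans l (ht-mono s′<s)))

  common-pred-below : ∀ {a b c γ} → ΔBelow a b γ → c <ₜ a → c <ₜ b → ht c < γ
  common-pred-below (δ , δ<γ , φ) c<a c<b =
    O.trans (subst (_< δ) (onto-segment-is-ht down φ _ (c<a , c<b)) (into φ _ (c<a , c<b))) δ<γ
    where
    down : ∀ {s t} → s <ₜ t → (t <ₜ _ × t <ₜ _) → (s <ₜ _ × s <ₜ _)
    down s<t (t<a , t<b) = <ₜ-trans s<t t<a , <ₜ-trans s<t t<b

  -- A countable level injects into ℕ, so equality on it is decidable.
  level-≟ : IsAronszajn W T → ∀ {s t} → ht s ≡ ht t → Dec (s ≡ t)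
  level-≟ A {s} {t} hs≡ht with IsAronszajn.countableLevels A (ht t)
  ... | e , e-inj with e s hs≡ht ℕ.≟ e t refl
  ... | yes eq = yes (e-inj s t hs≡ht refl eq)
  ... | no ne  = no λ { refl → ne (cong (e s) (Decidable⇒UIP.≡-irrelevant O._≟_ hs≡ht refl)) }

module Amalgamation (W : Omega1) (T U : Tree W) (p q : Condition W T U) (α β : Omega1.Ω W) where
  open Omega1 W
  private
    module O = IsStrictTotalOrder isSTO
    module T = Tree T
    module U = Tree U
    module TF = TreeFacts W T
    module UF = TreeFacts W U
  open T using () renaming (_<ₜ_ to _<T_)
  open U using () renaming (_<ₜ_ to _<U_)

  project : T.Carrier × U.Carrier → Ω → List (T.Carrier × U.Carrier)
  project (a , u) γ with T.ht a O.≟ β | γ O.<? α | γ O.<? T.ht a | γ O.<? U.ht u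
  ... | yes _ | no _ | yes γ<a | yes γ<u = [ proj₁ (TF.pred-at a γ<a) , proj₁ (UF.pred-at u γ<u) ]
  ... | _     | _    | _       | _       = []

  projections : List (T.Carrier × U.Carrier)
  projections = concatMap (λ z → concatMap (project z) (x p)) (f q)

  record Projection (c : T.Carrier) (w : U.Carrier) : Set where
    field
      aβ     : T.Carrier
      uβ     : U.Carrier
      aβuβ∈g : (aβ , uβ) ∈ f q
      ht-aβ  : T.ht aβ ≡ β
      c<aβ   : c <T aβ
      w<uβ   : w <U uβ
      ht-c∈x : T.ht c ∈ x p
      α≤ht-c : ¬ (T.ht c < α)
      ht-w   : U.ht w ≡ T.ht c

  project-sound : ∀ {a u γ c w} → (c , w) ∈ project (a , u) γ →
    T.ht a ≡ β × ¬ (γ < α) × c <T a × w <U u × T.ht c ≡ γ × U.ht w ≡ γ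
  project-sound {a} {u} {γ} m with T.ht a O.≟ β | γ O.<? α | γ O.<? T.ht a | γ O.<? U.ht u
  project-sound {a} {u} (here refl) | yes e | no γ≮α | yes γ<a | yes γ<u =
    let (_ , c<a , ht-c) = TF.pred-at a γ<a
        (_ , w<u , ht-w) = UF.pred-at u γ<u
    in e , γ≮α , c<a , w<u , ht-c , ht-w
  project-sound (there ()) | yes _ | no _ | yes _ | yes _
  project-sound ()         | yes _ | no _ | yes _ | no _
  project-sound ()         | yes _ | no _ | no _  | _
  project-sound ()         | yes _ | yes _ | _   | _
  project-sound ()         | no _  | _    | _    | _

  project-complete : ∀ {a u c} → T.ht a ≡ β → ¬ (T.ht c < α) → c <T a → T.ht c < U.ht u →
                     ∃ λ w → (c , w) ∈ project (a , u) (T.ht c)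
  project-complete {a} {u} {c} e c≮α c<a c<u
    with T.ht a O.≟ β | T.ht c O.<? α | T.ht c O.<? T.ht a | T.ht c O.<? U.ht u
  ... | yes _ | no _ | yes γ<a | yes _ =
    let (c′ , c′<a , ht-c′) = TF.pred-at a γ<a
    in _ , here (cong (_, _) (TF.preds-≡ c<a c′<a (sym ht-c′)))
  ... | no ne | _     | _     | _     = ⊥-elim (ne e)
  ... | yes _ | yes l | _     | _     = ⊥-elim (c≮α l)
  ... | yes _ | no _  | no n  | _     = ⊥-elim (n (TF.ht-mono c<a))
  ... | yes _ | no _  | yes _ | no n  = ⊥-elim (n c<u)

  projections-sound : ∀ {c w} → (c , w) ∈ projections → Projection c w
  projections-sound m with find (∈-concatMap⁻ (λ z → concatMap (project z) (x p)) {xs = f q} m)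
  ... | (a , u) , au∈g , m′ with find (∈-concatMap⁻ (project (a , u)) {xs = x p} m′)
  ... | γ , γ∈x , m″ with project-sound m″
  ... | e , γ≮α , c<a , w<u , refl , ht-w = record
    { aβ = a ; uβ = u ; aβuβ∈g = au∈g ; ht-aβ = e ; c<aβ = c<a ; w<uβ = w<u
    ; ht-c∈x = γ∈x ; α≤ht-c = γ≮α ; ht-w = ht-w }

  projections-complete : ∀ {a u c} → (a , u) ∈ f q → T.ht a ≡ β → c <T a → T.ht c ∈ x p →
                         ¬ (T.ht c < α) → ∃ λ w → (c , w) ∈ projections
  projections-complete {a} {u} {c} au∈g e c<a c∈x c≮α =
    let c<u = subst (T.ht c <_) (sym (htPres q a u au∈g)) (TF.ht-mono c<a)
        (w , m) = project-complete e c≮α c<a c<u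
    in w , ∈-concatMap⁺ (λ z → concatMap (project z) (x p))
             (lose au∈g (∈-concatMap⁺ (project (a , u)) (lose c∈x m)))

  module Amalgam
    (T-aronszajn : IsAronszajn W T)
    (β∈y : β ∈ x q)
    (x<β : ∀ ξ → ξ ∈ x p → ξ < β)
    (levels-agree : ∀ ξ → ((ξ ∈ x p × ξ < α) → (ξ ∈ x q × ξ < β))
                         × ((ξ ∈ x q × ξ < β) → (ξ ∈ x p × ξ < α)))
    (pairs-agree : ∀ a u → (((a , u) ∈ f p × T.ht a < α) → ((a , u) ∈ f q × T.ht a < β))
                         × (((a , u) ∈ f q × T.ht a < β) → ((a , u) ∈ f p × T.ht a < α)))
    (tops-split-below-α : ∀ a b u v → (a , u) ∈ f q → (b , v) ∈ f q →
                            T.ht a ≡ β → T.ht b ≡ β → a ≢ b → T.ΔBelow a b α × U.ΔBelow u v α)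
    (dom-incomparable : ∀ a u b v → (a , u) ∈ f p → (b , v) ∈ f q →
                          ¬ (T.ht a < α) → ¬ (T.ht b < β) → T.Incomparable a b)
    (ran-incomparable : ∀ a u b v → (a , u) ∈ f p → (b , v) ∈ f q →
                          ¬ (U.ht u < α) → ¬ (U.ht v < β) → U.Incomparable u v)
    where

    open Projection

    ≡β⇒≮β : ∀ {γ} → γ ≡ β → ¬ (γ < β)
    ≡β⇒≮β refl = TF.<-irrefl

    low-f⇒g : ∀ {a u} → (a , u) ∈ f p → T.ht a < α → (a , u) ∈ f q
    low-f⇒g m l = proj₁ (proj₁ (pairs-agree _ _) (m , l))

    low-g⇒f : ∀ {a u} → (a , u) ∈ f q → T.ht a < β → (a , u) ∈ f p
    low-g⇒f m l = proj₁ (proj₂ (pairs-agree _ _) (m , l))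

    low-x⇒y : ∀ {ξ} → ξ ∈ x p → ξ < α → ξ ∈ x q
    low-x⇒y m l = proj₁ (proj₁ (levels-agree _) (m , l))

    low-y⇒x : ∀ {ξ} → ξ ∈ x q → ξ < β → ξ ∈ x p
    low-y⇒x m l = proj₁ (proj₂ (levels-agree _) (m , l))

    dom-f<β : ∀ {a u} → (a , u) ∈ f p → T.ht a < β
    dom-f<β {a} {u} m = x<β _ (domInTx p a u m)

    ran-ht-f : ∀ {a u} → (a , u) ∈ f p → U.ht u ≡ T.ht a
    ran-ht-f {a} {u} = htPres p a u

    ran-ht-g : ∀ {a u} → (a , u) ∈ f q → U.ht u ≡ T.ht a
    ran-ht-g {a} {u} = htPres q a u

    high-f-not-below-top : ∀ {a u a₁ u₁} → (a , u) ∈ f p → ¬ (T.ht a < α) →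
                           (a₁ , u₁) ∈ f q → T.ht a₁ ≡ β → ¬ (a <T a₁)
    high-f-not-below-top m a≮α m₁ e = proj₁ (proj₂ (dom-incomparable _ _ _ _ m m₁ a≮α (≡β⇒≮β e)))

    high-ran-f-not-below-top : ∀ {a u a₁ u₁} → (a , u) ∈ f p → ¬ (U.ht u < α) →
                               (a₁ , u₁) ∈ f q → T.ht a₁ ≡ β → ¬ (u <U u₁)
    high-ran-f-not-below-top m u≮α m₁ e =
      proj₁ (proj₂ (ran-incomparable _ _ _ _ m m₁ u≮α (≡β⇒≮β (trans (ran-ht-g m₁) e))))

    tops-≡ : ∀ {a₁ u₁ a₂ u₂} → (a₁ , u₁) ∈ f q → (a₂ , u₂) ∈ f q → T.ht a₁ ≡ β → T.ht a₂ ≡ β →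
             ¬ (T.ΔBelow a₁ a₂ α × U.ΔBelow u₁ u₂ α) → a₁ ≡ a₂ × u₁ ≡ u₂
    tops-≡ {a₁} {u₁} {a₂} {u₂} m₁ m₂ e₁ e₂ ¬Δ<α with TF.level-≟ T-aronszajn (trans e₁ (sym e₂))
    ... | yes refl = refl , functional q a₁ u₁ u₂ m₁ m₂
    ... | no a₁≢a₂ = ⊥-elim (¬Δ<α (tops-split-below-α a₁ a₂ u₁ u₂ m₁ m₂ e₁ e₂ a₁≢a₂))

    top-unique-T : ∀ {c w a₂ u₂} (P : Projection c w) → (a₂ , u₂) ∈ f q → T.ht a₂ ≡ β →
                   c <T a₂ → aβ P ≡ a₂ × uβ P ≡ u₂
    top-unique-T P m₂ e₂ c<a₂ = tops-≡ (aβuβ∈g P) m₂ (ht-aβ P) e₂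
      λ (Δ , _) → α≤ht-c P (TF.common-pred-below Δ (c<aβ P) c<a₂)

    top-unique-U : ∀ {c w a₂ u₂} (P : Projection c w) → (a₂ , u₂) ∈ f q → T.ht a₂ ≡ β →
                   w <U u₂ → aβ P ≡ a₂ × uβ P ≡ u₂
    top-unique-U P m₂ e₂ w<u₂ = tops-≡ (aβuβ∈g P) m₂ (ht-aβ P) e₂
      λ (_ , Δ) → α≤ht-c P (subst (_< α) (ht-w P) (UF.common-pred-below Δ (w<uβ P) w<u₂))

    record Trace (a : T.Carrier) (u : U.Carrier) : Set where
      field
        tβ        : T.Carrier
        vβ        : U.Carrier
        tβvβ∈g    : (tβ , vβ) ∈ f q
        ht-tβ     : T.ht tβ ≡ β
        below-tβ  : ∀ {c} → c <T a → T.ht c < β → c <T tβ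
        vβ≤u      : ∀ {w} → w <U vβ → w <U u

    trace : ∀ {a u} → (a , u) ∈ f q → ¬ (T.ht a < β) → Trace a u
    trace {a} {u} m a≮β with O.compare (T.ht a) β
    ... | tri< a<β _ _ = ⊥-elim (a≮β a<β)
    ... | tri≈ _ e _ = record
      { tβ = a ; vβ = u ; tβvβ∈g = m ; ht-tβ = e ; below-tβ = λ c<a _ → c<a ; vβ≤u = λ w<u → w<u }
    ... | tri> _ _ β<a with TF.pred-at a β<a
    ...   | a′ , a′<a , e with domDown q a u a′ m a′<a (subst (_∈ x q) (sym e) β∈y)
    ...     | u′ , m′ = record
      { tβ = a′ ; vβ = u′ ; tβvβ∈g = m′ ; ht-tβ = e
      ; below-tβ = λ c<a c<β → TF.preds-< c<a a′<a (subst (T.ht _ <_) (sym e) c<β)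
      ; vβ≤u = λ w<u′ → U.trans w<u′ (increasing q a′ a u′ u m′ m a′<a) }

    data Origin (a : T.Carrier) (u : U.Carrier) : Set where
      from-f      : (a , u) ∈ f p → Origin a u
      from-high-g : (a , u) ∈ f q → ¬ (T.ht a < β) → Origin a u
      projected   : Projection a u → Origin a u

    x∪y : List Ω
    x∪y = x p ++ x q

    f∪g∪h : List (T.Carrier × U.Carrier)
    f∪g∪h = f p ++ f q ++ projections

    f⊆f∪g∪h : ∀ {z} → z ∈ f p → z ∈ f∪g∪h
    f⊆f∪g∪h = ∈-++⁺ˡ

    g⊆f∪g∪h : ∀ {z} → z ∈ f q → z ∈ f∪g∪h
    g⊆f∪g∪h m = ∈-++⁺ʳ (f p) (∈-++⁺ˡ m)

    h⊆f∪g∪h : ∀ {z} → z ∈ projections → z ∈ f∪g∪h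
    h⊆f∪g∪h m = ∈-++⁺ʳ (f p) (∈-++⁺ʳ (f q) m)

    origin : ∀ {a u} → (a , u) ∈ f∪g∪h → Origin a u
    origin {a} m with ∈-++⁻ (f p) m
    ... | inj₁ m-f = from-f m-f
    ... | inj₂ m′ with ∈-++⁻ (f q) m′
    ...   | inj₂ m-h = projected (projections-sound m-h)
    ...   | inj₁ m-g with T.ht a O.<? β
    ...     | yes a<β = from-f (low-g⇒f m-g a<β)
    ...     | no a≮β  = from-high-g m-g a≮β

    origin-htPres : ∀ {a u} → Origin a u → U.ht u ≡ T.ht a
    origin-htPres (from-f m)        = ran-ht-f m
    origin-htPres (from-high-g m _) = ran-ht-g m
    origin-htPres (projected P)     = ht-w P

    origin-ht∈x∪y : ∀ {a u} → Origin a u → T.ht a ∈ x∪y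
    origin-ht∈x∪y {a} {u} (from-f m)        = ∈-++⁺ˡ (domInTx p a u m)
    origin-ht∈x∪y {a} {u} (from-high-g m _) = ∈-++⁺ʳ (x p) (domInTx q a u m)
    origin-ht∈x∪y (projected P)             = ∈-++⁺ˡ (ht-c∈x P)

    origin-functional : ∀ {a u v} → Origin a u → Origin a v → u ≡ v
    origin-functional {a} {u} {v} (from-f m) (from-f m′) = functional p a u v m m′
    origin-functional (from-f m) (from-high-g _ a≮β) = ⊥-elim (a≮β (dom-f<β m))
    origin-functional (from-f m) (projected P) =
      ⊥-elim (high-f-not-below-top m (α≤ht-c P) (aβuβ∈g P) (ht-aβ P) (c<aβ P))
    origin-functional {a} {u} {v} (from-high-g m _) (from-high-g m′ _) = functional q a u v m m′
    origin-functional (from-high-g _ a≮β) (projected P) = ⊥-elim (a≮β (x<β _ (ht-c∈x P)))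
    origin-functional (projected P) (projected P′) =
      let (_ , uβ≡uβ′) = top-unique-T P (aβuβ∈g P′) (ht-aβ P′) (c<aβ P′)
      in UF.preds-≡ (w<uβ P) (subst (_ <U_) (sym uβ≡uβ′) (w<uβ P′)) (trans (ht-w P) (sym (ht-w P′)))
    origin-functional o@(from-high-g _ _) o′@(from-f _) = sym (origin-functional o′ o)
    origin-functional o@(projected _) o′@(from-f _) = sym (origin-functional o′ o)
    origin-functional o@(projected _) o′@(from-high-g _ _) = sym (origin-functional o′ o)

    origin-injective : ∀ {a b u} → Origin a u → Origin b u → a ≡ b
    origin-injective {a} {b} {u} (from-f m) (from-f m′) = injective p a b u m m′
    origin-injective (from-f m) (from-high-g m′ b≮β) =
      ⊥-elim (b≮β (subst (_< β) (trans (sym (ran-ht-f m)) (ran-ht-g m′)) (dom-f<β m)))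
    origin-injective (from-f m) (projected P) =
      ⊥-elim (high-ran-f-not-below-top m (λ u<α → α≤ht-c P (subst (_< α) (ht-w P) u<α))
                                         (aβuβ∈g P) (ht-aβ P) (w<uβ P))
    origin-injective {a} {b} {u} (from-high-g m _) (from-high-g m′ _) = injective q a b u m m′
    origin-injective (from-high-g m a≮β) (projected P) =
      ⊥-elim (a≮β (subst (_< β) (trans (sym (ht-w P)) (ran-ht-g m)) (x<β _ (ht-c∈x P))))
    origin-injective (projected P) (projected P′) =
      let (aβ≡aβ′ , _) = top-unique-U P (aβuβ∈g P′) (ht-aβ P′) (w<uβ P′)
      in TF.preds-≡ (c<aβ P) (subst (_ <T_) (sym aβ≡aβ′) (c<aβ P′)) (trans (sym (ht-w P)) (ht-w P′))
    origin-injective o@(from-high-g _ _) o′@(from-f _) = sym (origin-injective o′ o)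
    origin-injective o@(projected _) o′@(from-f _) = sym (origin-injective o′ o)
    origin-injective o@(projected _) o′@(from-high-g _ _) = sym (origin-injective o′ o)

    origin-increasing : ∀ {a b u v} → Origin a u → Origin b v → a <T b → u <U v
    origin-increasing {a} {b} {u} {v} (from-f m) (from-f m′) a<b = increasing p a b u v m m′ a<b
    origin-increasing {a} {b} {u} {v} (from-f m) (from-high-g m′ b≮β) a<b with T.ht a O.<? α
    ... | yes a<α = increasing q a b u v (low-f⇒g m a<α) m′ a<b
    ... | no a≮α  = ⊥-elim (proj₁ (proj₂ (dom-incomparable a u b v m m′ a≮α b≮β)) a<b)
    origin-increasing {a} {b} {u} {v} (from-f m) (projected P) a<b with T.ht a O.<? α
    ... | yes a<α =
      UF.preds-< (increasing q a (aβ P) u (uβ P) (low-f⇒g m a<α) (aβuβ∈g P) (T.trans a<b (c<aβ P)))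
                 (w<uβ P)
                 (subst₂ _<_ (sym (ran-ht-f m)) (sym (ht-w P)) (TF.ht-mono a<b))
    ... | no a≮α = ⊥-elim (high-f-not-below-top m a≮α (aβuβ∈g P) (ht-aβ P) (T.trans a<b (c<aβ P)))
    origin-increasing (from-high-g _ a≮β) (from-f m′) a<b =
      ⊥-elim (a≮β (O.trans (TF.ht-mono a<b) (dom-f<β m′)))
    origin-increasing {a} {b} {u} {v} (from-high-g m _) (from-high-g m′ _) a<b = increasing q a b u v m m′ a<b
    origin-increasing (from-high-g _ a≮β) (projected P′) a<b =
      ⊥-elim (a≮β (O.trans (TF.ht-mono a<b) (x<β _ (ht-c∈x P′))))
    origin-increasing {a} {b} {u} {v} (projected P) (from-f m′) a<b
      with domDown p b v a m′ a<b (ht-c∈x P)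
    ... | _ , m = ⊥-elim (high-f-not-below-top m (α≤ht-c P) (aβuβ∈g P) (ht-aβ P) (c<aβ P))
    origin-increasing (projected P) (from-high-g m′ b≮β) a<b =
      let open Trace (trace m′ b≮β)
          (_ , uβ≡vβ) = top-unique-T P tβvβ∈g ht-tβ (below-tβ a<b (x<β _ (ht-c∈x P)))
      in vβ≤u (subst (_ <U_) uβ≡vβ (w<uβ P))
    origin-increasing (projected P) (projected P′) a<b =
      let (_ , uβ≡uβ′) = top-unique-T P (aβuβ∈g P′) (ht-aβ P′) (T.trans a<b (c<aβ P′))
      in UF.preds-< (w<uβ P) (subst (_ <U_) (sym uβ≡uβ′) (w<uβ P′))
                    (subst₂ _<_ (sym (ht-w P)) (sym (ht-w P′)) (TF.ht-mono a<b))

    down-from-top : ∀ {a₁ u₁ b} → (a₁ , u₁) ∈ f q → T.ht a₁ ≡ β → b <T a₁ → T.ht b ∈ x p →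
                    ∃ λ v → (b , v) ∈ f∪g∪h
    down-from-top {a₁} {u₁} {b} m e b<a₁ b∈x with T.ht b O.<? α
    ... | yes b<α = map₂ g⊆f∪g∪h (domDown q a₁ u₁ b m b<a₁ (low-x⇒y b∈x b<α))
    ... | no b≮α  = map₂ h⊆f∪g∪h (projections-complete m e b<a₁ b∈x b≮α)

    origin-downClosed : ∀ {a u b} → Origin a u → b <T a → T.ht b ∈ x∪y → ∃ λ v → (b , v) ∈ f∪g∪h
    origin-downClosed {a} {u} {b} (from-f m) b<a b∈x∪y =
      map₂ f⊆f∪g∪h (domDown p a u b m b<a ([ id , low-y⇒x′ ]′ (∈-++⁻ (x p) b∈x∪y)))
      where
      low-y⇒x′ : T.ht b ∈ x q → T.ht b ∈ x p
      low-y⇒x′ b∈y = low-y⇒x b∈y (O.trans (TF.ht-mono b<a) (dom-f<β m))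
    origin-downClosed {a} {u} {b} (from-high-g m a≮β) b<a b∈x∪y with ∈-++⁻ (x p) b∈x∪y
    ... | inj₂ b∈y = map₂ g⊆f∪g∪h (domDown q a u b m b<a b∈y)
    ... | inj₁ b∈x = let open Trace (trace m a≮β)
                     in down-from-top tβvβ∈g ht-tβ (below-tβ b<a (x<β _ b∈x)) b∈x
    origin-downClosed {b = b} (projected P) b<a b∈x∪y with ∈-++⁻ (x p) b∈x∪y
    ... | inj₂ b∈y = map₂ g⊆f∪g∪h (domDown q (aβ P) (uβ P) b (aβuβ∈g P) (T.trans b<a (c<aβ P)) b∈y)
    ... | inj₁ b∈x = down-from-top (aβuβ∈g P) (ht-aβ P) (T.trans b<a (c<aβ P)) b∈x

    amalgam : Condition W T U
    amalgam = record
      { x          = x∪y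
      ; f          = f∪g∪h
      ; xLimit     = λ ξ m → [ xLimit p ξ , xLimit q ξ ]′ (∈-++⁻ (x p) m)
      ; functional = λ a u v m m′ → origin-functional (origin m) (origin m′)
      ; injective  = λ a b u m m′ → origin-injective (origin m) (origin m′)
      ; increasing = λ a b u v m m′ → origin-increasing (origin m) (origin m′)
      ; htPres     = λ a u m → origin-htPres (origin m)
      ; domInTx    = λ a u m → origin-ht∈x∪y (origin m)
      ; domDown    = λ a u b m → origin-downClosed (origin m)
      }

    amalgam-≤-p : _≤Q_ W T U amalgam p
    amalgam-≤-p = (λ _ → ∈-++⁺ˡ) , (λ _ → f⊆f∪g∪h)

    amalgam-≤-q : _≤Q_ W T U amalgam q
    amalgam-≤-q = (λ _ → ∈-++⁺ʳ (x p)) , (λ _ → g⊆f∪g∪h)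

lemma3p7 : (W : Omega1) → let open Omega1 W in
    (T U : Tree W) → IsNormal W T → IsAronszajn W T → IsNormal W U → IsAronszajn W U →
    (p q : Condition W T U) → (α β : Ω) → IsLimit α → IsLimit β → α < β →
    α ∈ x p → β ∈ x q →
    (∀ ξ → ξ ∈ x p → ξ < β) →
    (∀ ξ → ((ξ ∈ x p × ξ < α) → (ξ ∈ x q × ξ < β))
         × ((ξ ∈ x q × ξ < β) → (ξ ∈ x p × ξ < α))) →
    (∀ a u → (((a , u) ∈ f p × Tree.ht T a < α) → ((a , u) ∈ f q × Tree.ht T a < β))
           × (((a , u) ∈ f q × Tree.ht T a < β) → ((a , u) ∈ f p × Tree.ht T a < α))) →
    (∀ a b u v → (a , u) ∈ f q → (b , v) ∈ f q →
       Tree.ht T a ≡ β → Tree.ht T b ≡ β → a ≢ b →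
       Tree.ΔBelow T a b α × Tree.ΔBelow U u v α) →
    (∀ a u b v → (a , u) ∈ f p → (b , v) ∈ f q →
       ¬ (Tree.ht T a < α) → ¬ (Tree.ht T b < β) → Tree.Incomparable T a b) →
    (∀ a u b v → (a , u) ∈ f p → (b , v) ∈ f q →
       ¬ (Tree.ht U u < α) → ¬ (Tree.ht U v < β) → Tree.Incomparable U u v) →
    Compatible W T U p q
lemma3p7 W T U _ T-aronszajn _ _ p q α β _ _ _ _ β∈y x<β levels-agree pairs-agree
         tops-split-below-α dom-incomparable ran-incomparable =
  amalgam , amalgam-≤-p , amalgam-≤-q
  where
  open Amalgamation.Amalgam W T U p q α β T-aronszajn β∈y x<β levels-agree pairs-agree
                    tops-split-below-α dom-incomparable ran-incomparable
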